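{- For every integer $n\ge 0$ and any $y$, \[ \sum_{r=0}^{n}\tilde{w}_{n,r}(y)=w_{n}(y)\quad\text{and}\quad\sum_{r=0}^{n}\binom{n}{r}\phi_{r}(y)\tilde{w}_{n-r}(y)=w_{n}(y). \]
   Context: ${n\brace k}$ denotes the Stirling number of the second kind. $\phi_n(y)=\sum_{k=0}^n{n\brace k}y^k$, $w_n(y)=\sum_{k=0}^n{n\brace k}k!y^k$. $d_{k,r}$ is the number of permutations of a $k$-set with exactly $r$ fixed points ($d_{k,r}=\binom{k}{r}d_{k-r}$ for $k\ge r$, $0$ otherwise, $d_m=m!\sum_{i=0}^m(-1)^i/i!$); $\tilde{w}_{n,r}(y)=\sum_{k=0}^n{n\brace k}d_{k,r}y^k$ and $\tilde{w}_n(y)=\tilde{w}_{n,0}(y)$. -}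

module Defs where

open import Level using (Level)
open import Data.Nat using (ℕ; zero; suc; _∸_; _≤ᵇ_)
import Data.Nat as ℕ
open import Data.Nat.Combinatorics using (_C_; _P_)
open import Data.Nat.Base using (_!)
open import Data.Integer as ℤ using (ℤ; +_; -[1+_])
open import Data.Bool using (if_then_else_)
open import Algebra.Bundles using (CommutativeRing)
import Algebra.Bundles

S : ℕ → ℕ → ℕ
S zero    zero    = 1
S zero    (suc k) = 0
S (suc n) zero    = 0
S (suc n) (suc k) = suc k ℕ.* S n (suc k) ℕ.+ S n k

Σℤ : ℕ → (ℕ → ℤ) → ℤ
Σℤ zero    f = f 0
Σℤ (suc n) f = Σℤ n f ℤ.+ f (suc n)

-- derangement number  d_m = m! Σ_{i=0}^m (-1)^i / i!  =  Σ_{i=0}^m (-1)^i m!/i!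
-- where m!/i! = m P (m ∸ i) (falling factorial), an integer
d : ℕ → ℤ
d m = Σℤ m (λ i → (ℤ.- (+ 1)) ℤ.^ i ℤ.* + (m P (m ∸ i)))

dkr : ℕ → ℕ → ℤ
dkr k r = if r ≤ᵇ k then + (k C r) ℤ.* d (k ∸ r) else + 0

module _ {c ℓ : Level} (R : CommutativeRing c ℓ) where
  open CommutativeRing R
  open import Algebra.Definitions.RawSemiring (Algebra.Bundles.Semiring.rawSemiring semiring) using (_×_; _^_)

  ι : ℤ → Carrier
  ι (+ n)      = n × 1#
  ι -[1+ n ]   = - (suc n × 1#)

  ΣR : ℕ → (ℕ → Carrier) → Carrier
  ΣR zero    f = f 0
  ΣR (suc n) f = ΣR n f + f (suc n)

  φ : ℕ → Carrier → Carrier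
  φ n y = ΣR n (λ k → ι (+ S n k) * y ^ k)

  w : ℕ → Carrier → Carrier
  w n y = ΣR n (λ k → ι (+ (S n k ℕ.* k !)) * y ^ k)

  w̃r : ℕ → ℕ → Carrier → Carrier
  w̃r n r y = ΣR n (λ k → ι (+ S n k ℤ.* dkr k r) * y ^ k)

  w̃ : ℕ → Carrier → Carrier
  w̃ n y = w̃r n 0 y

{-# OPTIONS --safe #-}
-- Both identities are compared coefficientwise in y, in ℤ, and transported to R along ι.
-- The first reduces to Σ_r d_{k,r} = k!, i.e. to sorting the permutations of a k-set by their
-- fixed points. In the second, φ_r · w̃_{n−r} is a Cauchy product; summing its coefficients against
-- C(n,r) with Σ_r C(n,r) S(r,a) S(n−r,b) = C(a+b,a) S(n,a+b) leaves Σ_a C(k,a) d_{k−a} = k! again.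
-- That Stirling identity follows by induction on n from the recurrence for S and a Leibniz rule
-- for binomial convolutions.
module Submission where

open import Defs
open import Level using (Level)
open import Data.Nat using (ℕ; zero; suc; _∸_; _≤_; _<_; _≤′_; z≤n; s≤s; _!)
import Data.Nat as ℕ
import Data.Nat.Properties as ℕP
open import Data.Nat.Combinatorics using (_C_)
open import Data.Integer as ℤ using (ℤ; +_; -[1+_])
import Data.Integer.Properties as ℤP
open import Data.Product using (_×_; _,_)
open import Function using (_∘_; flip)
open import Algebra.Bundles using (CommutativeRing)
import Algebra.Bundles
import Algebra.Properties.CommutativeSemigroup as CommSemigroupProperties
open import Relation.Binary.PropositionalEquality as ≡ using (_≡_)

module FiniteSums {c ℓ : Level} (R : CommutativeRing c ℓ) where

  open CommutativeRing R hiding (zero)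
  open import Relation.Binary.Reasoning.Setoid setoid
  open import Algebra.Definitions.RawSemiring (Algebra.Bundles.Semiring.rawSemiring semiring) using (_^_)
  open import Algebra.Properties.Semiring.Exp semiring using (^-homo-*)
  open CommSemigroupProperties +-commutativeSemigroup using (interchange)
  open CommSemigroupProperties *-commutativeSemigroup using () renaming (interchange to *-interchange)

  Σ : ℕ → (ℕ → Carrier) → Carrier
  Σ = ΣR R

  Σ-cong≤ : ∀ n {f g : ℕ → Carrier} → (∀ i → i ≤ n → f i ≈ g i) → Σ n f ≈ Σ n g
  Σ-cong≤ zero    f≈g = f≈g 0 z≤n
  Σ-cong≤ (suc n) f≈g = +-cong (Σ-cong≤ n (λ i i≤n → f≈g i (ℕP.m≤n⇒m≤1+n i≤n))) (f≈g (suc n) ℕP.≤-refl)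

  Σ-cong : ∀ n {f g : ℕ → Carrier} → (∀ i → f i ≈ g i) → Σ n f ≈ Σ n g
  Σ-cong n f≈g = Σ-cong≤ n (λ i _ → f≈g i)

  Σ-zero : ∀ n {f : ℕ → Carrier} → (∀ i → f i ≈ 0#) → Σ n f ≈ 0#
  Σ-zero zero    f≈0 = f≈0 0
  Σ-zero (suc n) f≈0 = trans (+-cong (Σ-zero n f≈0) (f≈0 (suc n))) (+-identityˡ 0#)

  Σ-distrib-+ : ∀ n (f g : ℕ → Carrier) → Σ n (λ i → f i + g i) ≈ Σ n f + Σ n g
  Σ-distrib-+ zero    f g = refl
  Σ-distrib-+ (suc n) f g = trans (+-cong (Σ-distrib-+ n f g) refl) (interchange _ _ _ _)

  *-distribˡ-Σ : ∀ n a (f : ℕ → Carrier) → a * Σ n f ≈ Σ n (λ i → a * f i)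
  *-distribˡ-Σ zero    a f = refl
  *-distribˡ-Σ (suc n) a f = trans (distribˡ a _ _) (+-cong (*-distribˡ-Σ n a f) refl)

  *-distribʳ-Σ : ∀ n a (f : ℕ → Carrier) → Σ n f * a ≈ Σ n (λ i → f i * a)
  *-distribʳ-Σ n a f = trans (*-comm _ a) (trans (*-distribˡ-Σ n a f) (Σ-cong n (λ i → *-comm a (f i))))

  Σ-comm : ∀ m n (f : ℕ → ℕ → Carrier) → Σ m (λ i → Σ n (f i)) ≈ Σ n (λ j → Σ m (λ i → f i j))
  Σ-comm zero    n f = refl
  Σ-comm (suc m) n f = trans (+-cong (Σ-comm m n f) refl) (sym (Σ-distrib-+ n _ _))

  Σ-suc : ∀ n (f : ℕ → Carrier) → Σ (suc n) f ≈ f 0 + Σ n (f ∘ suc)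
  Σ-suc zero    f = refl
  Σ-suc (suc n) f = trans (+-cong (Σ-suc n f) refl) (+-assoc _ _ _)

  Σ-truncate : ∀ {m n} (f : ℕ → Carrier) → m ≤ n → (∀ i → m < i → f i ≈ 0#) → Σ n f ≈ Σ m f
  Σ-truncate {m} f m≤n f≈0 = go (ℕP.≤⇒≤′ m≤n)
    where
    go : ∀ {n} → m ≤′ n → Σ n f ≈ Σ m f
    go ℕ.≤′-refl         = refl
    go (ℕ.≤′-step m≤′n) = trans (+-cong (go m≤′n) (f≈0 _ (s≤s (ℕP.≤′⇒≤ m≤′n)))) (+-identityʳ _)

  Σ-reverse : ∀ n (f : ℕ → Carrier) → Σ n f ≈ Σ n (λ i → f (n ∸ i))
  Σ-reverse zero    f = refl
  Σ-reverse (suc n) f = sym (begin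
    Σ (suc n) (λ i → f (suc n ∸ i))     ≈⟨ Σ-suc n _ ⟩
    f (suc n) + Σ n (λ i → f (n ∸ i))   ≈⟨ +-cong refl (Σ-reverse n f) ⟨
    f (suc n) + Σ n f                    ≈⟨ +-comm _ _ ⟩
    Σ (suc n) f                          ∎)

  Σ-triangle : ∀ n (g : ℕ → ℕ → Carrier) →
               Σ n (λ k → Σ k (λ i → g i (k ∸ i))) ≈ Σ n (λ i → Σ (n ∸ i) (g i))
  Σ-triangle zero    g = refl
  Σ-triangle (suc n) g = begin
    Σ n (λ k → Σ k (λ i → g i (k ∸ i))) + (Σ n (λ i → g i (suc n ∸ i)) + g (suc n) (n ∸ n))
      ≈⟨ +-cong (Σ-triangle n g) (+-cong (Σ-cong≤ n (λ i i≤n → reflexive (≡.cong (g i) (ℕP.+-∸-assoc 1 i≤n)))) lastTerm) ⟩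
    Σ n (λ i → Σ (n ∸ i) (g i)) + (Σ n (λ i → g i (suc (n ∸ i))) + Σ (suc n ∸ suc n) (g (suc n)))
      ≈⟨ +-assoc _ _ _ ⟨
    (Σ n (λ i → Σ (n ∸ i) (g i)) + Σ n (λ i → g i (suc (n ∸ i)))) + Σ (suc n ∸ suc n) (g (suc n))
      ≈⟨ +-cong (Σ-distrib-+ n _ _) refl ⟨
    Σ n (λ i → Σ (suc (n ∸ i)) (g i)) + Σ (suc n ∸ suc n) (g (suc n))
      ≈⟨ +-cong (Σ-cong≤ n (λ i i≤n → reflexive (≡.cong (λ m → Σ m (g i)) (≡.sym (ℕP.+-∸-assoc 1 i≤n))))) refl ⟩
    Σ (suc n) (λ i → Σ (suc n ∸ i) (g i)) ∎
    where
    lastTerm : g (suc n) (n ∸ n) ≈ Σ (n ∸ n) (g (suc n))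
    lastTerm rewrite ℕP.n∸n≡0 n = refl

  -- The left side also contains the terms of total degree > n; the hypothesis makes them vanish.
  Σ-cauchy-product : ∀ n (p q : ℕ → Carrier) y → (∀ i j → n < i ℕ.+ j → p i * q j ≈ 0#) →
    Σ n (λ i → p i * y ^ i) * Σ n (λ j → q j * y ^ j) ≈ Σ n (λ k → Σ k (λ i → p i * q (k ∸ i)) * y ^ k)
  Σ-cauchy-product n p q y pq≈0 = begin
    Σ n (λ i → p i * y ^ i) * Σ n (λ j → q j * y ^ j)
      ≈⟨ *-distribʳ-Σ n _ _ ⟩
    Σ n (λ i → (p i * y ^ i) * Σ n (λ j → q j * y ^ j))
      ≈⟨ Σ-cong n (λ i → trans (*-distribˡ-Σ n _ _) (Σ-cong n (λ j → monomial-* i j))) ⟩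
    Σ n (λ i → Σ n (h i))
      ≈⟨ Σ-cong n (λ i → Σ-truncate (h i) (ℕP.m∸n≤m n i) (λ j n∸i<j → h≈0 i j n∸i<j)) ⟩
    Σ n (λ i → Σ (n ∸ i) (h i))
      ≈⟨ Σ-triangle n h ⟨
    Σ n (λ k → Σ k (λ i → h i (k ∸ i)))
      ≈⟨ Σ-cong n (λ k → Σ-cong≤ k (λ i i≤k → *-cong refl (reflexive (≡.cong (y ^_) (ℕP.m+[n∸m]≡n i≤k))))) ⟩
    Σ n (λ k → Σ k (λ i → (p i * q (k ∸ i)) * y ^ k))
      ≈⟨ Σ-cong n (λ k → *-distribʳ-Σ k _ _) ⟨
    Σ n (λ k → Σ k (λ i → p i * q (k ∸ i)) * y ^ k) ∎
    where
    h : ℕ → ℕ → Carrier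
    h i j = (p i * q j) * y ^ (i ℕ.+ j)
    monomial-* : ∀ i j → (p i * y ^ i) * (q j * y ^ j) ≈ h i j
    monomial-* i j = trans (*-interchange _ _ _ _) (*-cong refl (sym (^-homo-* y i j)))
    h≈0 : ∀ i j → n ∸ i < j → h i j ≈ 0#
    h≈0 i j n∸i<j = trans (*-cong (pq≈0 i j (ℕP.≤-<-trans (ℕP.m≤n+m∸n n i) (ℕP.+-monoʳ-< i n∸i<j))) refl) (zeroˡ _)

module IntegerImage {c ℓ : Level} (R : CommutativeRing c ℓ) where

  open CommutativeRing R hiding (zero)
  open import Relation.Binary.Reasoning.Setoid setoid
  open import Algebra.Properties.Ring ring using (-0#≈0#; -‿involutive; -‿+-comm; -‿distribˡ-*; -‿distribʳ-*)
  open import Algebra.Properties.Semiring.Mult semiring using (×-homo-+; ×1-homo-*)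
  open CommSemigroupProperties +-commutativeSemigroup using (interchange)
  open FiniteSums R using (Σ)
  private module Σℤ = FiniteSums ℤP.+-*-commutativeRing

  -‿cancel-1#+ : ∀ a b → (1# + a) - (1# + b) ≈ a - b
  -‿cancel-1#+ a b = begin
    (1# + a) + - (1# + b)   ≈⟨ +-cong refl (-‿+-comm 1# b) ⟨
    (1# + a) + (- 1# + - b) ≈⟨ interchange _ _ _ _ ⟩
    (1# - 1#) + (a - b)     ≈⟨ +-cong (-‿inverseʳ 1#) refl ⟩
    0# + (a - b)            ≈⟨ +-identityˡ _ ⟩
    a - b                   ∎

  ι-⊖ : ∀ m n → ι R (m ℤ.⊖ n) ≈ ι R (+ m) - ι R (+ n)
  ι-⊖ m       zero    = trans (reflexive (≡.cong (ι R) (ℤP.⊖-≥ {m} z≤n))) (sym (trans (+-cong refl -0#≈0#) (+-identityʳ _)))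
  ι-⊖ zero    (suc n) = sym (+-identityˡ _)
  ι-⊖ (suc m) (suc n) = trans (reflexive (≡.cong (ι R) (ℤP.[1+m]⊖[1+n]≡m⊖n m n)))
                              (trans (ι-⊖ m n) (sym (-‿cancel-1#+ _ _)))

  ι-neg : ∀ x → ι R (ℤ.- x) ≈ - ι R x
  ι-neg (+ zero)  = sym -0#≈0#
  ι-neg (+ suc n) = refl
  ι-neg -[1+ n ]  = sym (-‿involutive _)

  ι-+ : ∀ x y → ι R (x ℤ.+ y) ≈ ι R x + ι R y
  ι-+ (+ m)    (+ n)    = ×-homo-+ 1# m n
  ι-+ (+ m)    -[1+ n ] = ι-⊖ m (suc n)
  ι-+ -[1+ m ] (+ n)    = trans (ι-⊖ n (suc m)) (+-comm _ _)
  ι-+ -[1+ m ] -[1+ n ] = begin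
    - ι R (+ suc (suc (m ℕ.+ n)))       ≈⟨ -‿cong (reflexive (≡.cong (ι R ∘ +_) (≡.sym (ℕP.+-suc (suc m) n)))) ⟩
    - ι R (+ (suc m ℕ.+ suc n))         ≈⟨ -‿cong (×-homo-+ 1# (suc m) (suc n)) ⟩
    - (ι R (+ suc m) + ι R (+ suc n))   ≈⟨ -‿+-comm _ _ ⟨
    - ι R (+ suc m) + - ι R (+ suc n)   ∎

  ι-*-pos : ∀ m y → ι R (+ m ℤ.* y) ≈ ι R (+ m) * ι R y
  ι-*-pos m (+ n)    = trans (reflexive (≡.cong (ι R) (≡.sym (ℤP.pos-* m n)))) (×1-homo-* m n)
  ι-*-pos m -[1+ n ] = begin
    ι R (+ m ℤ.* -[1+ n ])        ≈⟨ reflexive (≡.cong (ι R) (≡.sym (ℤP.neg-distribʳ-* (+ m) (+ suc n)))) ⟩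
    ι R (ℤ.- (+ m ℤ.* + suc n))   ≈⟨ ι-neg (+ m ℤ.* + suc n) ⟩
    - ι R (+ m ℤ.* + suc n)       ≈⟨ -‿cong (ι-*-pos m (+ suc n)) ⟩
    - (ι R (+ m) * ι R (+ suc n)) ≈⟨ -‿distribʳ-* _ _ ⟩
    ι R (+ m) * - ι R (+ suc n)   ∎

  ι-* : ∀ x y → ι R (x ℤ.* y) ≈ ι R x * ι R y
  ι-* (+ m)    y = ι-*-pos m y
  ι-* -[1+ m ] y = begin
    ι R (-[1+ m ] ℤ.* y)          ≈⟨ reflexive (≡.cong (ι R) (≡.sym (ℤP.neg-distribˡ-* (+ suc m) y))) ⟩
    ι R (ℤ.- (+ suc m ℤ.* y))     ≈⟨ ι-neg (+ suc m ℤ.* y) ⟩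
    - ι R (+ suc m ℤ.* y)         ≈⟨ -‿cong (ι-*-pos (suc m) y) ⟩
    - (ι R (+ suc m) * ι R y)     ≈⟨ -‿distribˡ-* _ _ ⟩
    - ι R (+ suc m) * ι R y       ∎

  ι-Σ : ∀ n (f : ℕ → ℤ) → ι R (Σℤ.Σ n f) ≈ Σ n (ι R ∘ f)
  ι-Σ zero    f = refl
  ι-Σ (suc n) f = trans (ι-+ (Σℤ.Σ n f) (f (suc n))) (+-cong (ι-Σ n f) refl)

module IntegerCombinatorics where

  open import Data.Bool using (true; false; T; if_then_else_)
  open import Data.Unit using (tt)
  open import Data.Empty using (⊥-elim)
  open import Relation.Nullary using (¬_)
  open import Data.Nat.Combinatorics using (_P_; nCk+nC[k+1]≡[n+1]C[k+1]; k>n⇒nCk≡0; nCn≡1; nC1≡n; nCk≡nC[n∸k])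
  open import Data.Nat.Combinatorics.Base using (_P′_)
  open import Data.Nat.Combinatorics.Specification using (nP′k≡n[n∸1P′k∸1])
  open import Data.Integer.Tactic.RingSolver using (solve-∀)
  open import Data.Integer using (_+_; _*_; -_)
  open FiniteSums ℤP.+-*-commutativeRing
  open CommSemigroupProperties ℤP.+-commutativeSemigroup using (x∙yz≈y∙xz)
  open CommSemigroupProperties ℤP.*-commutativeSemigroup using () renaming (x∙yz≈y∙xz to *-x∙yz≈y∙xz)
  open ≡.≡-Reasoning

  -- Binomial coefficients

  binom : ℕ → ℕ → ℤ
  binom n r = + (n C r)

  binom-vanish : ∀ {n r} → n < r → binom n r ≡ + 0
  binom-vanish n<r = ≡.cong +_ (k>n⇒nCk≡0 n<r)

  pascal : ∀ n r → binom (suc n) (suc r) ≡ binom n r + binom n (suc r)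
  pascal n r = ≡.trans (≡.cong +_ (≡.sym (nCk+nC[k+1]≡[n+1]C[k+1] n r))) (ℤP.pos-+ (n C r) (n C suc r))

  Σ-pascal : ∀ n (g : ℕ → ℤ) →
    Σ (suc n) (λ r → binom (suc n) r * g r) ≡ Σ n (λ r → binom n r * g (suc r)) + Σ n (λ r → binom n r * g r)
  Σ-pascal n g = begin
    Σ (suc n) (λ r → binom (suc n) r * g r)
      ≡⟨ Σ-suc n _ ⟩
    g₀ + Σ n (λ r → binom (suc n) (suc r) * g (suc r))
      ≡⟨ ≡.cong (_+_ g₀) (Σ-cong n split) ⟩
    g₀ + Σ n (λ r → binom n r * g (suc r) + binom n (suc r) * g (suc r))
      ≡⟨ ≡.cong (_+_ g₀) (Σ-distrib-+ n _ _) ⟩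
    g₀ + (A + Σ n (λ r → binom n (suc r) * g (suc r)))
      ≡⟨ x∙yz≈y∙xz g₀ A _ ⟩
    A + (g₀ + Σ n (λ r → binom n (suc r) * g (suc r)))
      ≡⟨ ≡.cong (_+_ A) (Σ-suc n (λ r → binom n r * g r)) ⟨
    A + Σ (suc n) (λ r → binom n r * g r)
      ≡⟨ ≡.cong (_+_ A) (Σ-truncate _ (ℕP.n≤1+n n) (λ r n<r → ≡.cong (_* g r) (binom-vanish n<r))) ⟩
    A + Σ n (λ r → binom n r * g r) ∎
    where
    g₀ A : ℤ
    g₀ = binom (suc n) 0 * g 0
    A = Σ n (λ r → binom n r * g (suc r))
    split : ∀ r → binom (suc n) (suc r) * g (suc r) ≡ binom n r * g (suc r) + binom n (suc r) * g (suc r)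
    split r = ≡.trans (≡.cong (_* g (suc r)) (pascal n r)) (ℤP.*-distribʳ-+ (g (suc r)) (binom n r) (binom n (suc r)))

  sign : ℕ → ℤ
  sign j = (- + 1) ℤ.^ j

  Σ-binom-sign : ∀ m → Σ (suc m) (λ j → binom (suc m) j * sign j) ≡ + 0
  Σ-binom-sign m = begin
    Σ (suc m) (λ j → binom (suc m) j * sign j)          ≡⟨ Σ-pascal m sign ⟩
    Σ m (λ j → binom m j * sign (suc j)) + A             ≡⟨ ≡.cong (_+ A) (Σ-cong m (λ j → *-x∙yz≈y∙xz (binom m j) (- + 1) (sign j))) ⟩
    Σ m (λ j → - + 1 * (binom m j * sign j)) + A         ≡⟨ ≡.cong (_+ A) (*-distribˡ-Σ m (- + 1) _) ⟨
    - + 1 * A + A                                        ≡⟨ ≡.cong (_+ A) (ℤP.-1*i≡-i A) ⟩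
    - A + A                                              ≡⟨ ℤP.+-inverseˡ A ⟩
    + 0                                                  ∎
    where
    A : ℤ
    A = Σ m (λ j → binom m j * sign j)

  absorption : ∀ k r → + suc r * binom (suc k) (suc r) ≡ + suc k * binom k r
  absorption k zero = begin
    + 1 * binom (suc k) 1   ≡⟨ ℤP.*-identityˡ _ ⟩
    + (suc k C 1)           ≡⟨ ≡.cong +_ (nC1≡n (suc k)) ⟩
    + suc k                 ≡⟨ ℤP.*-identityʳ _ ⟨
    + suc k * + 1           ∎
  absorption zero (suc r) = ℤP.*-zeroʳ (+ suc (suc r))
  absorption (suc k) (suc r) = begin
    (+ 1 + + suc r) * binom (suc (suc k)) (suc (suc r))   ≡⟨ ≡.cong (_*_ (+ 1 + + suc r)) (pascal (suc k) (suc r)) ⟩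
    (+ 1 + + suc r) * (X + Y)                             ≡⟨ expand (+ suc r) X Y ⟩
    X + + suc r * X + + suc (suc r) * Y                   ≡⟨ ≡.cong₂ (λ u v → X + u + v) (absorption k r) (absorption k (suc r)) ⟩
    X + K * binom k r + K * binom k (suc r)               ≡⟨ ℤP.+-assoc X (K * binom k r) (K * binom k (suc r)) ⟩
    X + (K * binom k r + K * binom k (suc r))             ≡⟨ ≡.cong (_+_ X) (ℤP.*-distribˡ-+ K (binom k r) (binom k (suc r))) ⟨
    X + K * (binom k r + binom k (suc r))                 ≡⟨ ≡.cong (λ z → X + K * z) (pascal k r) ⟨
    X + K * X                                             ≡⟨ ≡.cong (_+ K * X) (ℤP.*-identityˡ X) ⟨
    + 1 * X + K * X                                       ≡⟨ ℤP.*-distribʳ-+ X (+ 1) K ⟨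
    (+ 1 + K) * X                                         ∎
    where
    X Y K : ℤ
    X = binom (suc k) (suc r)
    Y = binom (suc k) (suc (suc r))
    K = + suc k
    expand : ∀ a x y → (+ 1 + a) * (x + y) ≡ x + a * x + (+ 1 + a) * y
    expand = solve-∀

  -- Derangement numbers

  if-T : ∀ {a} {A : Set a} b {x y : A} → T b → (if b then x else y) ≡ x
  if-T true _ = ≡.refl

  if-¬T : ∀ {a} {A : Set a} b {x y : A} → ¬ T b → (if b then x else y) ≡ y
  if-¬T false _   = ≡.refl
  if-¬T true  ¬tt = ⊥-elim (¬tt tt)

  Σℤ≡Σ : ∀ n f → Σℤ n f ≡ Σ n f
  Σℤ≡Σ zero    f = ≡.refl
  Σℤ≡Σ (suc n) f = ≡.cong (_+ f (suc n)) (Σℤ≡Σ n f)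

  P≡P′ : ∀ {n k} → k ≤ n → n P k ≡ n P′ k
  P≡P′ {n} {k} k≤n = if-T (k ℕ.≤ᵇ n) (ℕP.≤⇒≤ᵇ k≤n)

  falling-suc : ∀ {m i} → i ≤ m → suc m P (suc m ∸ i) ≡ suc m ℕ.* (m P (m ∸ i))
  falling-suc {m} {i} i≤m = begin
    suc m P (suc m ∸ i)         ≡⟨ ≡.cong (suc m P_) (ℕP.+-∸-assoc 1 i≤m) ⟩
    suc m P suc (m ∸ i)         ≡⟨ P≡P′ (s≤s (ℕP.m∸n≤m m i)) ⟩
    suc m P′ suc (m ∸ i)        ≡⟨ nP′k≡n[n∸1P′k∸1] (suc m) (suc (m ∸ i)) ⟩
    suc m ℕ.* (m P′ (m ∸ i))    ≡⟨ ≡.cong (suc m ℕ.*_) (P≡P′ (ℕP.m∸n≤m m i)) ⟨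
    suc m ℕ.* (m P (m ∸ i))     ∎

  d-suc : ∀ m → d (suc m) ≡ + suc m * d m + sign (suc m)
  d-suc m = ≡.cong₂ _+_ scaled lastTerm
    where
    term : ℕ → ℤ
    term i = sign i * + (m P (m ∸ i))
    rescale : ∀ i → i ≤ m → sign i * + (suc m P (suc m ∸ i)) ≡ + suc m * term i
    rescale i i≤m = begin
      sign i * + (suc m P (suc m ∸ i))        ≡⟨ ≡.cong (λ x → sign i * + x) (falling-suc i≤m) ⟩
      sign i * + (suc m ℕ.* (m P (m ∸ i)))    ≡⟨ ≡.cong (_*_ (sign i)) (ℤP.pos-* (suc m) _) ⟩
      sign i * (+ suc m * + (m P (m ∸ i)))    ≡⟨ *-x∙yz≈y∙xz (sign i) (+ suc m) _ ⟩
      + suc m * term i                        ∎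
    scaled : Σℤ m (λ i → sign i * + (suc m P (suc m ∸ i))) ≡ + suc m * d m
    scaled = begin
      Σℤ m (λ i → sign i * + (suc m P (suc m ∸ i)))   ≡⟨ Σℤ≡Σ m _ ⟩
      Σ m (λ i → sign i * + (suc m P (suc m ∸ i)))    ≡⟨ Σ-cong≤ m rescale ⟩
      Σ m (λ i → + suc m * term i)                    ≡⟨ *-distribˡ-Σ m (+ suc m) term ⟨
      + suc m * Σ m term                              ≡⟨ ≡.cong (_*_ (+ suc m)) (Σℤ≡Σ m term) ⟨
      + suc m * d m                                   ∎
    lastTerm : sign (suc m) * + (suc m P (m ∸ m)) ≡ sign (suc m)
    lastTerm rewrite ℕP.n∸n≡0 m = ℤP.*-identityʳ (sign (suc m))

  -- Counting permutations of a k-set by their set of non-fixed points.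
  Σ-binom-d : ∀ k → Σ k (λ r → binom k r * d r) ≡ + (k !)
  Σ-binom-d zero    = ≡.refl
  Σ-binom-d (suc k) = begin
    Σ (suc k) (λ r → binom (suc k) r * d r)
      ≡⟨ Σ-suc k _ ⟩
    + 1 + Σ k (λ r → binom (suc k) (suc r) * d (suc r))
      ≡⟨ ≡.cong (_+_ (+ 1)) (Σ-cong k expand) ⟩
    + 1 + Σ k (λ r → K * (binom k r * d r) + binom (suc k) (suc r) * sign (suc r))
      ≡⟨ ≡.cong (_+_ (+ 1)) (Σ-distrib-+ k _ _) ⟩
    + 1 + (Σ k (λ r → K * (binom k r * d r)) + V)
      ≡⟨ ≡.cong (λ z → + 1 + (z + V)) (*-distribˡ-Σ k K _) ⟨
    + 1 + (K * Σ k (λ r → binom k r * d r) + V)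
      ≡⟨ x∙yz≈y∙xz (+ 1) (K * Σ k (λ r → binom k r * d r)) V ⟩
    K * Σ k (λ r → binom k r * d r) + (+ 1 + V)
      ≡⟨ ≡.cong₂ _+_ (≡.cong (_*_ K) (Σ-binom-d k)) (≡.trans (≡.sym (Σ-suc k _)) (Σ-binom-sign k)) ⟩
    K * + (k !) + + 0
      ≡⟨ ℤP.+-identityʳ _ ⟩
    K * + (k !)
      ≡⟨ ℤP.pos-* (suc k) (k !) ⟨
    + (suc k !) ∎
    where
    K V : ℤ
    K = + suc k
    V = Σ k (λ r → binom (suc k) (suc r) * sign (suc r))
    regroup : ∀ c x s e → c * (s * x + e) ≡ (s * c) * x + c * e
    regroup = solve-∀
    expand : ∀ r → binom (suc k) (suc r) * d (suc r) ≡ K * (binom k r * d r) + binom (suc k) (suc r) * sign (suc r)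
    expand r = begin
      B * d (suc r)                            ≡⟨ ≡.cong (_*_ B) (d-suc r) ⟩
      B * (+ suc r * d r + sign (suc r))       ≡⟨ regroup B (d r) (+ suc r) (sign (suc r)) ⟩
      (+ suc r * B) * d r + B * sign (suc r)   ≡⟨ ≡.cong (λ z → z * d r + B * sign (suc r)) (absorption k r) ⟩
      (K * binom k r) * d r + B * sign (suc r) ≡⟨ ≡.cong (_+ B * sign (suc r)) (ℤP.*-assoc K (binom k r) (d r)) ⟩
      K * (binom k r * d r) + B * sign (suc r) ∎
      where
      B : ℤ
      B = binom (suc k) (suc r)

  Σ-binom-d-reversed : ∀ k → Σ k (λ r → binom k r * d (k ∸ r)) ≡ + (k !)
  Σ-binom-d-reversed k = ≡.trans (Σ-reverse k _) (≡.trans (Σ-cong≤ k flip-index) (Σ-binom-d k))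
    where
    flip-index : ∀ r → r ≤ k → binom k (k ∸ r) * d (k ∸ (k ∸ r)) ≡ binom k r * d r
    flip-index r r≤k = ≡.cong₂ (λ u v → + u * d v) (≡.sym (nCk≡nC[n∸k] r≤k)) (ℕP.m∸[m∸n]≡n r≤k)

  dkr-≤ : ∀ {k r} → r ≤ k → dkr k r ≡ binom k r * d (k ∸ r)
  dkr-≤ {k} {r} r≤k = if-T (r ℕ.≤ᵇ k) (ℕP.≤⇒≤ᵇ r≤k)

  dkr-> : ∀ {k r} → k < r → dkr k r ≡ + 0
  dkr-> {k} {r} k<r = if-¬T (r ℕ.≤ᵇ k) (ℕP.<⇒≱ k<r ∘ ℕP.≤ᵇ⇒≤ r k)

  Σ-dkr : ∀ {k n} → k ≤ n → Σ n (dkr k) ≡ + (k !)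
  Σ-dkr {k} {n} k≤n = begin
    Σ n (dkr k)                            ≡⟨ Σ-truncate (dkr k) k≤n (λ r k<r → dkr-> k<r) ⟩
    Σ k (dkr k)                            ≡⟨ Σ-cong≤ k (λ r r≤k → dkr-≤ r≤k) ⟩
    Σ k (λ r → binom k r * d (k ∸ r))      ≡⟨ Σ-binom-d-reversed k ⟩
    + (k !)                                ∎

  -- Stirling numbers and binomial convolution

  Sℤ : ℕ → ℕ → ℤ
  Sℤ n k = + S n k

  Sℤ⁻ : ℕ → ℕ → ℤ
  Sℤ⁻ n zero    = + 0
  Sℤ⁻ n (suc k) = Sℤ n k

  S-vanish : ∀ {n k} → n < k → S n k ≡ 0
  S-vanish {zero}  {suc k} _         = ≡.refl
  S-vanish {suc n} {suc k} (s≤s n<k) = begin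
    suc k ℕ.* S n (suc k) ℕ.+ S n k ≡⟨ ≡.cong₂ (λ a b → suc k ℕ.* a ℕ.+ b) (S-vanish (ℕP.m<n⇒m<1+n n<k)) (S-vanish n<k) ⟩
    suc k ℕ.* 0 ℕ.+ 0               ≡⟨ ℕP.+-identityʳ _ ⟩
    suc k ℕ.* 0                     ≡⟨ ℕP.*-zeroʳ (suc k) ⟩
    0                               ∎

  Sℤ-suc : ∀ n k → Sℤ (suc n) k ≡ + k * Sℤ n k + Sℤ⁻ n k
  Sℤ-suc n zero    = ≡.refl
  Sℤ-suc n (suc k) = ≡.trans (ℤP.pos-+ (suc k ℕ.* S n (suc k)) (S n k)) (≡.cong (_+ Sℤ n k) (ℤP.pos-* (suc k) (S n (suc k))))

  infixl 7 _⊛_ _⋆_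

  _⊛_ : (ℕ → ℤ) → (ℕ → ℤ) → ℕ → ℤ
  (p ⊛ q) n = Σ n (λ r → binom n r * (p r * q (n ∸ r)))

  _⋆_ : (ℕ → ℤ) → (ℕ → ℤ) → ℕ → ℤ
  (a ⋆ b) k = Σ k (λ i → a i * b (k ∸ i))

  -- The Leibniz rule for the shift operator, as for exponential generating functions.
  ⊛-suc : ∀ p q n → (p ⊛ q) (suc n) ≡ ((p ∘ suc) ⊛ q) n + (p ⊛ (q ∘ suc)) n
  ⊛-suc p q n = ≡.trans (Σ-pascal n (λ r → p r * q (suc n ∸ r))) (≡.cong (_+_ (((p ∘ suc) ⊛ q) n)) (Σ-cong≤ n shift))
    where
    shift : ∀ r → r ≤ n → binom n r * (p r * q (suc n ∸ r)) ≡ binom n r * (p r * q (suc (n ∸ r)))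
    shift r r≤n = ≡.cong (λ m → binom n r * (p r * q m)) (ℕP.+-∸-assoc 1 r≤n)

  ⊛-comm : ∀ p q n → (p ⊛ q) n ≡ (q ⊛ p) n
  ⊛-comm p q n = ≡.trans (Σ-reverse n _) (Σ-cong≤ n reflect)
    where
    reflect : ∀ r → r ≤ n → binom n (n ∸ r) * (p (n ∸ r) * q (n ∸ (n ∸ r))) ≡ binom n r * (q r * p (n ∸ r))
    reflect r r≤n = begin
      binom n (n ∸ r) * (p (n ∸ r) * q (n ∸ (n ∸ r)))  ≡⟨ ≡.cong₂ (λ u v → + u * (p (n ∸ r) * q v)) (≡.sym (nCk≡nC[n∸k] r≤n)) (ℕP.m∸[m∸n]≡n r≤n) ⟩
      binom n r * (p (n ∸ r) * q r)                    ≡⟨ ≡.cong (_*_ (binom n r)) (ℤP.*-comm (p (n ∸ r)) (q r)) ⟩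
      binom n r * (q r * p (n ∸ r))                    ∎

  ⊛-zeroˡ : ∀ q n → ((λ _ → + 0) ⊛ q) n ≡ + 0
  ⊛-zeroˡ q n = Σ-zero n (λ r → ℤP.*-zeroʳ (binom n r))

  ⊛-zeroʳ : ∀ p n → (p ⊛ (λ _ → + 0)) n ≡ + 0
  ⊛-zeroʳ p n = ≡.trans (⊛-comm p (λ _ → + 0) n) (⊛-zeroˡ p n)

  ⊛-linearˡ : ∀ α {p₁} p p′ q n → (∀ r → p₁ r ≡ α * p r + p′ r) → (p₁ ⊛ q) n ≡ α * (p ⊛ q) n + (p′ ⊛ q) n
  ⊛-linearˡ α {p₁} p p′ q n p₁≡ = begin
    (p₁ ⊛ q) n
      ≡⟨ Σ-cong n (λ r → ≡.trans (≡.cong (λ x → binom n r * (x * q (n ∸ r))) (p₁≡ r)) (distribute α (binom n r) (p r) (p′ r) (q (n ∸ r)))) ⟩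
    Σ n (λ r → α * (binom n r * (p r * q (n ∸ r))) + binom n r * (p′ r * q (n ∸ r)))
      ≡⟨ Σ-distrib-+ n _ _ ⟩
    Σ n (λ r → α * (binom n r * (p r * q (n ∸ r)))) + (p′ ⊛ q) n
      ≡⟨ ≡.cong (_+ (p′ ⊛ q) n) (*-distribˡ-Σ n α _) ⟨
    α * (p ⊛ q) n + (p′ ⊛ q) n ∎
    where
    distribute : ∀ a c x x′ y → c * ((a * x + x′) * y) ≡ a * (c * (x * y)) + c * (x′ * y)
    distribute = solve-∀

  ⊛-linearʳ : ∀ β p {q₁} q q′ n → (∀ r → q₁ r ≡ β * q r + q′ r) → (p ⊛ q₁) n ≡ β * (p ⊛ q) n + (p ⊛ q′) n
  ⊛-linearʳ β p {q₁} q q′ n q₁≡ = begin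
    (p ⊛ q₁) n                  ≡⟨ ⊛-comm p q₁ n ⟩
    (q₁ ⊛ p) n                  ≡⟨ ⊛-linearˡ β q q′ p n q₁≡ ⟩
    β * (q ⊛ p) n + (q′ ⊛ p) n  ≡⟨ ≡.cong₂ (λ u v → β * u + v) (⊛-comm q p n) (⊛-comm q′ p n) ⟩
    β * (p ⊛ q) n + (p ⊛ q′) n  ∎

  ⊛-Stirling-suc : ∀ n a b → (flip Sℤ a ⊛ flip Sℤ b) (suc n)
                 ≡ (+ a + + b) * (flip Sℤ a ⊛ flip Sℤ b) n + (flip Sℤ⁻ a ⊛ flip Sℤ b) n + (flip Sℤ a ⊛ flip Sℤ⁻ b) n
  ⊛-Stirling-suc n a b = begin
    (flip Sℤ a ⊛ flip Sℤ b) (suc n)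
      ≡⟨ ⊛-suc (flip Sℤ a) (flip Sℤ b) n ⟩
    ((flip Sℤ a ∘ suc) ⊛ flip Sℤ b) n + (flip Sℤ a ⊛ (flip Sℤ b ∘ suc)) n
      ≡⟨ ≡.cong₂ _+_ (⊛-linearˡ (+ a) (flip Sℤ a) (flip Sℤ⁻ a) (flip Sℤ b) n (λ r → Sℤ-suc r a))
                     (⊛-linearʳ (+ b) (flip Sℤ a) (flip Sℤ b) (flip Sℤ⁻ b) n (λ r → Sℤ-suc r b)) ⟩
    (+ a * t + (flip Sℤ⁻ a ⊛ flip Sℤ b) n) + (+ b * t + (flip Sℤ a ⊛ flip Sℤ⁻ b) n)
      ≡⟨ regroup (+ a) (+ b) t _ _ ⟩
    (+ a + + b) * t + (flip Sℤ⁻ a ⊛ flip Sℤ b) n + (flip Sℤ a ⊛ flip Sℤ⁻ b) n ∎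
    where
    t : ℤ
    t = (flip Sℤ a ⊛ flip Sℤ b) n
    regroup : ∀ a b t l r → (a * t + l) + (b * t + r) ≡ (a + b) * t + l + r
    regroup = solve-∀

  binom-diag : ∀ m n → binom (m ℕ.+ 0) m * Sℤ n (m ℕ.+ 0) ≡ Sℤ n m
  binom-diag m n rewrite ℕP.+-identityʳ m | nCn≡1 m = ℤP.*-identityˡ (Sℤ n m)

  -- Marking a of the a + b blocks of a partition of an n-set amounts to splitting the set in two
  -- and partitioning the parts into a and b blocks.
  ⊛-Stirling : ∀ n a b → (flip Sℤ a ⊛ flip Sℤ b) n ≡ binom (a ℕ.+ b) a * Sℤ n (a ℕ.+ b)
  ⊛-Stirling zero    zero    zero    = ≡.refl
  ⊛-Stirling zero    zero    (suc b) = ≡.refl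
  ⊛-Stirling zero    (suc a) b       = ≡.sym (ℤP.*-zeroʳ (binom (suc a ℕ.+ b) (suc a)))
  ⊛-Stirling (suc n) a b = ≡.trans (⊛-Stirling-suc n a b) (combine a b)
    where
    combine : ∀ a b → (+ a + + b) * (flip Sℤ a ⊛ flip Sℤ b) n + (flip Sℤ⁻ a ⊛ flip Sℤ b) n + (flip Sℤ a ⊛ flip Sℤ⁻ b) n
                    ≡ binom (a ℕ.+ b) a * Sℤ (suc n) (a ℕ.+ b)
    combine zero zero = ≡.cong₂ (λ l r → + 0 + l + r) (⊛-zeroˡ (flip Sℤ 0) n) (⊛-zeroʳ (flip Sℤ 0) n)
    combine zero (suc b) = begin
      + suc b * (flip Sℤ 0 ⊛ flip Sℤ (suc b)) n + ((λ _ → + 0) ⊛ flip Sℤ (suc b)) n + (flip Sℤ 0 ⊛ flip Sℤ b) n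
        ≡⟨ ≡.cong₂ (λ t r → + suc b * t + ((λ _ → + 0) ⊛ flip Sℤ (suc b)) n + r) (⊛-Stirling n 0 (suc b)) (⊛-Stirling n 0 b) ⟩
      + suc b * (+ 1 * Sℤ n (suc b)) + ((λ _ → + 0) ⊛ flip Sℤ (suc b)) n + + 1 * Sℤ n b
        ≡⟨ ≡.cong (λ l → + suc b * (+ 1 * Sℤ n (suc b)) + l + + 1 * Sℤ n b) (⊛-zeroˡ (flip Sℤ (suc b)) n) ⟩
      + suc b * (+ 1 * Sℤ n (suc b)) + + 0 + + 1 * Sℤ n b
        ≡⟨ factor (+ suc b) (Sℤ n (suc b)) (Sℤ n b) ⟩
      + 1 * (+ suc b * Sℤ n (suc b) + Sℤ n b)
        ≡⟨ ≡.cong (_*_ (+ 1)) (Sℤ-suc n (suc b)) ⟨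
      + 1 * Sℤ (suc n) (suc b) ∎
      where
      factor : ∀ k s s′ → k * (+ 1 * s) + + 0 + + 1 * s′ ≡ + 1 * (k * s + s′)
      factor = solve-∀
    combine (suc a) zero = begin
      (+ suc a + + 0) * (flip Sℤ (suc a) ⊛ flip Sℤ 0) n + (flip Sℤ a ⊛ flip Sℤ 0) n + (flip Sℤ (suc a) ⊛ (λ _ → + 0)) n
        ≡⟨ ≡.cong₂ (λ t l → (+ suc a + + 0) * t + l + (flip Sℤ (suc a) ⊛ (λ _ → + 0)) n)
                   (≡.trans (⊛-Stirling n (suc a) 0) (binom-diag (suc a) n))
                   (≡.trans (⊛-Stirling n a 0) (binom-diag a n)) ⟩
      (+ suc a + + 0) * Sℤ n (suc a) + Sℤ n a + (flip Sℤ (suc a) ⊛ (λ _ → + 0)) n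
        ≡⟨ ≡.cong₂ (λ k r → k * Sℤ n (suc a) + Sℤ n a + r) (ℤP.+-identityʳ (+ suc a)) (⊛-zeroʳ (flip Sℤ (suc a)) n) ⟩
      + suc a * Sℤ n (suc a) + Sℤ n a + + 0
        ≡⟨ ℤP.+-identityʳ _ ⟩
      + suc a * Sℤ n (suc a) + Sℤ n a
        ≡⟨ Sℤ-suc n (suc a) ⟨
      Sℤ (suc n) (suc a)
        ≡⟨ binom-diag (suc a) (suc n) ⟨
      binom (suc a ℕ.+ 0) (suc a) * Sℤ (suc n) (suc a ℕ.+ 0) ∎
    combine (suc a) (suc b) = begin
      + suc m * (flip Sℤ (suc a) ⊛ flip Sℤ (suc b)) n + (flip Sℤ a ⊛ flip Sℤ (suc b)) n + (flip Sℤ (suc a) ⊛ flip Sℤ b) n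
        ≡⟨ ≡.cong₂ (λ t l → + suc m * t + l + (flip Sℤ (suc a) ⊛ flip Sℤ b) n) (⊛-Stirling n (suc a) (suc b)) (⊛-Stirling n a (suc b)) ⟩
      + suc m * (binom (suc m) (suc a) * Sℤ n (suc m)) + binom m a * Sℤ n m + (flip Sℤ (suc a) ⊛ flip Sℤ b) n
        ≡⟨ ≡.cong₂ (λ c r → + suc m * (c * Sℤ n (suc m)) + binom m a * Sℤ n m + r)
                   (pascal m a)
                   (≡.trans (⊛-Stirling n (suc a) b) (≡.cong (λ j → binom j (suc a) * Sℤ n j) (≡.sym (ℕP.+-suc a b)))) ⟩
      + suc m * ((binom m a + binom m (suc a)) * Sℤ n (suc m)) + binom m a * Sℤ n m + binom m (suc a) * Sℤ n m
        ≡⟨ factor (+ suc m) (binom m a) (binom m (suc a)) (Sℤ n (suc m)) (Sℤ n m) ⟩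
      (binom m a + binom m (suc a)) * (+ suc m * Sℤ n (suc m) + Sℤ n m)
        ≡⟨ ≡.cong₂ _*_ (pascal m a) (Sℤ-suc n (suc m)) ⟨
      binom (suc m) (suc a) * Sℤ (suc n) (suc m) ∎
      where
      m : ℕ
      m = a ℕ.+ suc b
      factor : ∀ k x y s s′ → k * ((x + y) * s) + x * s′ + y * s′ ≡ (x + y) * (k * s + s′)
      factor = solve-∀

  w-coeff : ℕ → ℕ → ℤ
  w-coeff n k = + (S n k ℕ.* k !)

  w̃r-coeff : ℕ → ℕ → ℕ → ℤ
  w̃r-coeff n r k = Sℤ n k * dkr k r

  Σ-w̃r-coeff : ∀ {n k} → k ≤ n → Σ n (λ r → w̃r-coeff n r k) ≡ w-coeff n k
  Σ-w̃r-coeff {n} {k} k≤n = begin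
    Σ n (λ r → Sℤ n k * dkr k r)   ≡⟨ *-distribˡ-Σ n (Sℤ n k) (dkr k) ⟨
    Sℤ n k * Σ n (dkr k)           ≡⟨ ≡.cong (_*_ (Sℤ n k)) (Σ-dkr k≤n) ⟩
    Sℤ n k * + (k !)               ≡⟨ ℤP.pos-* (S n k) (k !) ⟨
    w-coeff n k                    ∎

  Σ-binom-Sℤ⋆w̃-coeff : ∀ n k → Σ n (λ r → binom n r * (Sℤ r ⋆ w̃r-coeff (n ∸ r) 0) k) ≡ w-coeff n k
  Σ-binom-Sℤ⋆w̃-coeff n k = begin
    Σ n (λ r → binom n r * Σ k (λ i → Sℤ r i * w̃r-coeff (n ∸ r) 0 (k ∸ i)))
      ≡⟨ Σ-cong n (λ r → *-distribˡ-Σ k (binom n r) _) ⟩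
    Σ n (λ r → Σ k (λ i → binom n r * (Sℤ r i * w̃r-coeff (n ∸ r) 0 (k ∸ i))))
      ≡⟨ Σ-comm n k _ ⟩
    Σ k (λ i → Σ n (λ r → binom n r * (Sℤ r i * w̃r-coeff (n ∸ r) 0 (k ∸ i))))
      ≡⟨ Σ-cong k (λ i → ≡.trans (Σ-cong n (λ r → pull-d (binom n r) (Sℤ r i) (Sℤ (n ∸ r) (k ∸ i)) (d (k ∸ i))))
                                (≡.sym (*-distribˡ-Σ n (d (k ∸ i)) (λ r → binom n r * (Sℤ r i * Sℤ (n ∸ r) (k ∸ i)))))) ⟩
    Σ k (λ i → d (k ∸ i) * (flip Sℤ i ⊛ flip Sℤ (k ∸ i)) n)
      ≡⟨ Σ-cong≤ k (λ i i≤k → ≡.cong (_*_ (d (k ∸ i))) (≡.trans (⊛-Stirling n i (k ∸ i)) (≡.cong (λ j → binom j i * Sℤ n j) (ℕP.m+[n∸m]≡n i≤k)))) ⟩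
    Σ k (λ i → d (k ∸ i) * (binom k i * Sℤ n k))
      ≡⟨ Σ-cong k (λ i → swap (d (k ∸ i)) (binom k i) (Sℤ n k)) ⟩
    Σ k (λ i → Sℤ n k * (binom k i * d (k ∸ i)))
      ≡⟨ *-distribˡ-Σ k (Sℤ n k) _ ⟨
    Sℤ n k * Σ k (λ i → binom k i * d (k ∸ i))
      ≡⟨ ≡.cong (_*_ (Sℤ n k)) (Σ-binom-d-reversed k) ⟩
    Sℤ n k * + (k !)
      ≡⟨ ℤP.pos-* (S n k) (k !) ⟨
    w-coeff n k ∎
    where
    -- dkr j 0 unfolds to + 1 * d j.
    pull-d : ∀ c s s′ e → c * (s * (s′ * (+ 1 * e))) ≡ e * (c * (s * s′))
    pull-d = solve-∀
    swap : ∀ e c s → e * (c * s) ≡ s * (c * e)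
    swap = solve-∀

module Polynomials {c ℓ : Level} (R : CommutativeRing c ℓ) where

  open CommutativeRing R hiding (zero)
  open import Relation.Binary.Reasoning.Setoid setoid
  open import Algebra.Definitions.RawSemiring (Algebra.Bundles.Semiring.rawSemiring semiring) using (_^_)
  open import Data.Sum using (_⊎_; inj₁; inj₂)
  open import Relation.Nullary using (yes; no)
  open FiniteSums R
  open IntegerImage R
  open IntegerCombinatorics using (_⋆_)
  private module Σℤ = FiniteSums ℤP.+-*-commutativeRing

  poly : ℕ → (ℕ → ℤ) → Carrier → Carrier
  poly n a y = Σ n (λ k → ι R (a k) * y ^ k)

  poly-cong : ∀ n {a b : ℕ → ℤ} y → (∀ k → k ≤ n → a k ≡ b k) → poly n a y ≈ poly n b y
  poly-cong n y a≡b = Σ-cong≤ n (λ k k≤n → *-cong (reflexive (≡.cong (ι R) (a≡b k k≤n))) refl)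

  Σ-poly : ∀ m n (a : ℕ → ℕ → ℤ) y → Σ m (λ r → poly n (a r) y) ≈ poly n (λ k → Σℤ.Σ m (λ r → a r k)) y
  Σ-poly m n a y = begin
    Σ m (λ r → Σ n (λ k → ι R (a r k) * y ^ k))     ≈⟨ Σ-comm m n _ ⟩
    Σ n (λ k → Σ m (λ r → ι R (a r k) * y ^ k))     ≈⟨ Σ-cong n (λ k → *-distribʳ-Σ m (y ^ k) _) ⟨
    Σ n (λ k → Σ m (λ r → ι R (a r k)) * y ^ k)     ≈⟨ Σ-cong n (λ k → *-cong (ι-Σ m (λ r → a r k)) refl) ⟨
    poly n (λ k → Σℤ.Σ m (λ r → a r k)) y           ∎

  ι-*-poly : ∀ n x a y → ι R x * poly n a y ≈ poly n (λ k → x ℤ.* a k) y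
  ι-*-poly n x a y = begin
    ι R x * Σ n (λ k → ι R (a k) * y ^ k)           ≈⟨ *-distribˡ-Σ n (ι R x) _ ⟩
    Σ n (λ k → ι R x * (ι R (a k) * y ^ k))         ≈⟨ Σ-cong n (λ k → trans (*-cong (ι-* x (a k)) refl) (*-assoc _ _ _)) ⟨
    poly n (λ k → x ℤ.* a k) y                      ∎

  poly-truncate : ∀ {m n} (a : ℕ → ℤ) y → m ≤ n → (∀ k → m < k → a k ≡ + 0) → poly n a y ≈ poly m a y
  poly-truncate a y m≤n a≡0 = Σ-truncate _ m≤n (λ k m<k → trans (*-cong (reflexive (≡.cong (ι R) (a≡0 k m<k))) refl) (zeroˡ _))

  poly-* : ∀ m l (a b : ℕ → ℤ) y → (∀ k → m < k → a k ≡ + 0) → (∀ k → l < k → b k ≡ + 0) →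
           poly m a y * poly l b y ≈ poly (m ℕ.+ l) (a ⋆ b) y
  poly-* m l a b y a≡0 b≡0 = begin
    poly m a y * poly l b y
      ≈⟨ *-cong (poly-truncate a y (ℕP.m≤m+n m l) a≡0) (poly-truncate b y (ℕP.m≤n+m l m) b≡0) ⟨
    poly (m ℕ.+ l) a y * poly (m ℕ.+ l) b y
      ≈⟨ Σ-cauchy-product (m ℕ.+ l) (ι R ∘ a) (ι R ∘ b) y ab≈0 ⟩
    Σ (m ℕ.+ l) (λ k → Σ k (λ i → ι R (a i) * ι R (b (k ∸ i))) * y ^ k)
      ≈⟨ Σ-cong (m ℕ.+ l) (λ k → *-cong (trans (ι-Σ k (λ i → a i ℤ.* b (k ∸ i))) (Σ-cong k (λ i → ι-* (a i) (b (k ∸ i))))) refl) ⟨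
    poly (m ℕ.+ l) (a ⋆ b) y ∎
    where
    split : ∀ {i j} → m ℕ.+ l < i ℕ.+ j → m < i ⊎ l < j
    split {i} {j} lt with m ℕ.<? i
    ... | yes m<i = inj₁ m<i
    ... | no  m≮i = inj₂ (ℕP.≰⇒> (λ j≤l → ℕP.<⇒≱ lt (ℕP.+-mono-≤ (ℕP.≮⇒≥ m≮i) j≤l)))
    ab≈0 : ∀ i j → m ℕ.+ l < i ℕ.+ j → ι R (a i) * ι R (b j) ≈ 0#
    ab≈0 i j lt with split lt
    ... | inj₁ m<i = trans (*-cong (reflexive (≡.cong (ι R) (a≡0 i m<i))) refl) (zeroˡ _)
    ... | inj₂ l<j = trans (*-cong refl (reflexive (≡.cong (ι R) (b≡0 j l<j)))) (zeroʳ _)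

module TouchardIdentities {c ℓ : Level} (R : CommutativeRing c ℓ) where

  open CommutativeRing R hiding (zero)
  open import Relation.Binary.Reasoning.Setoid setoid
  open FiniteSums R using (Σ-cong≤)
  open Polynomials R
  open IntegerCombinatorics

  Σ-w̃r≈w : ∀ n y → ΣR R n (λ r → w̃r R n r y) ≈ w R n y
  Σ-w̃r≈w n y = trans (Σ-poly n n (w̃r-coeff n) y) (poly-cong n y (λ k k≤n → Σ-w̃r-coeff k≤n))

  Σ-binom-φ-w̃≈w : ∀ n y → ΣR R n (λ r → (ι R (binom n r) * φ R r y) * w̃ R (n ∸ r) y) ≈ w R n y
  Σ-binom-φ-w̃≈w n y = begin
    ΣR R n (λ r → (ι R (binom n r) * φ R r y) * w̃ R (n ∸ r) y)   ≈⟨ Σ-cong≤ n product ⟩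
    ΣR R n (λ r → poly n (coeff r) y)                              ≈⟨ Σ-poly n n coeff y ⟩
    poly n (λ k → FiniteSums.Σ ℤP.+-*-commutativeRing n (λ r → coeff r k)) y
                                                                   ≈⟨ poly-cong n y (λ k _ → Σ-binom-Sℤ⋆w̃-coeff n k) ⟩
    w R n y                                                        ∎
    where
    coeff : ℕ → ℕ → ℤ
    coeff r k = binom n r ℤ.* (Sℤ r ⋆ w̃r-coeff (n ∸ r) 0) k
    product : ∀ r → r ≤ n → (ι R (binom n r) * φ R r y) * w̃ R (n ∸ r) y ≈ poly n (coeff r) y
    product r r≤n = begin
      (ι R (binom n r) * poly r (Sℤ r) y) * poly (n ∸ r) (w̃r-coeff (n ∸ r) 0) y
        ≈⟨ *-assoc _ _ _ ⟩
      ι R (binom n r) * (poly r (Sℤ r) y * poly (n ∸ r) (w̃r-coeff (n ∸ r) 0) y)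
        ≈⟨ *-cong refl (poly-* r (n ∸ r) (Sℤ r) (w̃r-coeff (n ∸ r) 0) y
                               (λ k r<k → ≡.cong +_ (S-vanish r<k))
                               (λ k n∸r<k → ≡.cong (λ s → + s ℤ.* dkr k 0) (S-vanish n∸r<k))) ⟩
      ι R (binom n r) * poly (r ℕ.+ (n ∸ r)) (Sℤ r ⋆ w̃r-coeff (n ∸ r) 0) y
        ≈⟨ ι-*-poly (r ℕ.+ (n ∸ r)) (binom n r) _ y ⟩
      poly (r ℕ.+ (n ∸ r)) (coeff r) y
        ≡⟨ ≡.cong (λ m → poly m (coeff r) y) (ℕP.m+[n∸m]≡n r≤n) ⟩
      poly n (coeff r) y ∎

mainTheorem13 : {c ℓ : Level} (R : CommutativeRing c ℓ) (n : ℕ) (y : CommutativeRing.Carrier R) →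
    CommutativeRing._≈_ R (ΣR R n (λ r → w̃r R n r y)) (w R n y)
    × CommutativeRing._≈_ R
        (ΣR R n (λ r → CommutativeRing._*_ R (CommutativeRing._*_ R (ι R (+ (n C r))) (φ R r y)) (w̃ R (n ∸ r) y)))
        (w R n y)
mainTheorem13 R n y = Σ-w̃r≈w n y , Σ-binom-φ-w̃≈w n y
  where open TouchardIdentities R
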